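{- Let $p \geq 2$ be an integer. Then $\zeta(C_{2p} \square C_4) = 3$.
   Context: The localization game on a connected graph $G$ is played by a Cop controlling $k$ cops and a Robber. The Robber first chooses a vertex $r$, unknown to the Cop. In each turn the Cop probes a set $B=\{b_1,\dots,b_k\}$ of $k$ vertices and receives the distance vector $[d_G(r,b_1),\dots,d_G(r,b_k)]$. If the Cop can determine $r$ exactly, the Cop wins; otherwise the Robber may stay at $r$ or move to a neighbour of $r$, and the next turn begins. The Cop wins if the Robber is located after finitely many turns. The localization number $\zeta(G)$ is the least positive integer $k$ such that the Cop has a winning strategy with $k$ cops. $C_n$ is the cycle of order $n$ and $\square$ the Cartesian product. -}

module Defs where

open import Data.Nat using (ℕ; zero; suc; _+_; _*_; _≤_; _<_)
open import Data.Bool using (Bool; true; false; _∨_; _∧_; if_then_else_)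
open import Data.Fin using (Fin; toℕ)
open import Data.Fin.Properties using () renaming (_≟_ to _≟F_)
open import Data.List using (List; []; _∷_; length; cartesianProduct; allFin)
open import Data.Bool.ListAction using (any)
open import Data.Vec using (Vec; map)
open import Data.Product using (Σ; ∃; _×_; _,_)
open import Data.Sum using (_⊎_)
open import Relation.Nullary using (¬_)
open import Relation.Nullary.Decidable using (⌊_⌋)
open import Relation.Binary.PropositionalEquality using (_≡_)
open import Relation.Binary using (DecidableEquality)
open import Data.Nat using () renaming (_≟_ to _≟ℕ_)

record FinGraph : Set₁ where
  field
    V     : Set
    _≟V_  : DecidableEquality V
    verts : List V          -- enumeration of all vertices
    adj   : V → V → Bool

module _ (G : FinGraph) where
  open FinGraph G

  reach : ℕ → V → V → Bool
  reach zero    u v = ⌊ u ≟V v ⌋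
  reach (suc k) u v = reach k u v ∨ any (λ w → reach k u w ∧ adj w v) verts

  search : ℕ → ℕ → V → V → ℕ
  search zero     k u v = k
  search (suc f)  k u v = if reach k u v then k else search f (suc k) u v

  -- graph distance d_G(u,v): the least length of a u–v walk
  -- (for a connected graph this is < number of vertices, so the
  --  search bound is never reached)
  dist : V → V → ℕ
  dist u v = search (length verts) 0 u v

  IsRobberWalk : (ℕ → V) → Set
  IsRobberWalk r = ∀ t → r (suc t) ≡ r t ⊎ adj (r t) (r (suc t)) ≡ true

  -- Cop's strategy: the probe set of the next turn as a function of the
  -- distance vectors received so far (most recent first).
  Strategy : ℕ → Set
  Strategy k = List (Vec ℕ k) → Vec V k

  mutual
    history : ∀ {k} → Strategy k → (ℕ → V) → ℕ → List (Vec ℕ k)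
    history σ r zero    = []
    history σ r (suc t) = response σ r t ∷ history σ r t

    response : ∀ {k} → Strategy k → (ℕ → V) → ℕ → Vec ℕ k
    response σ r t = map (dist (r t)) (σ (history σ r t))

  Located : ∀ {k} → Strategy k → (ℕ → V) → ℕ → Set
  Located σ r t = ∀ r' → IsRobberWalk r' →
                  history σ r' (suc t) ≡ history σ r (suc t) → r' t ≡ r t

  CopWins : ℕ → Set
  CopWins k = Σ (Strategy k) λ σ → ∀ r → IsRobberWalk r → ∃ λ t → Located σ r t

  IsLocalizationNumber : ℕ → Set
  IsLocalizationNumber k =
    1 ≤ k × CopWins k × (∀ j → 1 ≤ j → j < k → ¬ CopWins j)

cycleAdj : (m : ℕ) → Fin m → Fin m → Bool
cycleAdj m i j = next i j ∨ next j i
  where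
    next : Fin m → Fin m → Bool
    next i j = ⌊ toℕ j ≟ℕ suc (toℕ i) ⌋
             ∨ (⌊ suc (toℕ i) ≟ℕ m ⌋ ∧ ⌊ toℕ j ≟ℕ 0 ⌋)

Cycle : ℕ → FinGraph
Cycle m = record { V = Fin m ; _≟V_ = _≟F_ ; verts = allFin m ; adj = cycleAdj m }

_□_ : FinGraph → FinGraph → FinGraph
G □ H = record
  { V     = G.V × H.V
  ; _≟V_  = ≡-dec G._≟V_ H._≟V_
  ; verts = cartesianProduct G.verts H.verts
  ; adj   = λ { (a , b) (a' , b') →
              (⌊ a G.≟V a' ⌋ ∧ H.adj b b') ∨ (⌊ b H.≟V b' ⌋ ∧ G.adj a a') }
  }
  where
    module G = FinGraph G
    module H = FinGraph H
    open import Data.Product.Properties using (≡-dec)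

-- Distances in C_{2h} □ C_4 are sums of distances in the two cycles. Three cops win
-- in two rounds: probing (0,0), (0,1), (0,2) reveals the row β of the robber; after
-- its move, probing (0,β+1), (0,β−1) and (2h−1,β+1) reveals its new row from the
-- first two answers and then its column from the distances to columns 0 and 2h−1.
-- Against two cops the robber keeps two twin positions that no probe tells apart:
-- either in one column two rows apart, or diagonally adjacent in neighbouring
-- columns. A probe sees the columns a−1, …, a+2 around the twins only through three
-- bits saying whether the distance grows at each step, so a finite search over all
-- bits and rows shows that the twins can always move to a new such configuration.
-- One cop is weaker than two.

module Submission where

open import Defs

open import Data.Nat
open import Data.Nat.Properties
open import Data.Nat.DivMod using (_%_; %-distribˡ-+; m%n%n≡m%n; [m+n]%n≡m%n; m%n<n; m<n⇒m%n≡m; n%n≡0)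
open import Data.Bool using (Bool; true; false; _∨_; _∧_; if_then_else_; T)
open import Data.Unit using (tt)
open import Data.Fin using (Fin; zero; suc; toℕ; fromℕ; fromℕ<)
open import Data.Fin.Properties
  using (toℕ-injective; toℕ<n; toℕ-fromℕ; toℕ-fromℕ<; all?) renaming (_≟_ to _≟ᶠ_)
open import Data.Product using (∃-syntax; _×_; _,_; proj₁; proj₂)
open import Data.Sum using (_⊎_; inj₁; inj₂)
open import Data.List using (List; []; _∷_; length; map; _++_; cartesianProduct; allFin)
open import Data.List.Properties using (length-++; length-map; length-tabulate; ∷-injective)
open import Data.Vec using (Vec; []; _∷_; lookup; head; tail) renaming (map to mapᵥ)
open import Data.Vec.Properties using (map-cong)
open import Data.List.Membership.Propositional using (_∈_)
open import Data.List.Membership.Propositional.Properties using (∈-cartesianProduct⁺; ∈-allFin)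
open import Data.List.Relation.Unary.Any using (here; there)
open import Data.Bool.ListAction using (any; all)
open import Algebra.Properties.CommutativeSemigroup +-commutativeSemigroup using (interchange; xy∙z≈xz∙y)
open import Relation.Nullary using (¬_; Dec; yes; no; contradiction)
open import Relation.Nullary.Decidable
  using (⌊_⌋; dec-true; isYes≗does; _⊎-dec_; _×-dec_; _→-dec_; ¬?; from-yes)
open import Relation.Binary.PropositionalEquality
open import Function using (_∘_)

∨-true⁻ : ∀ {a b} → a ∨ b ≡ true → a ≡ true ⊎ b ≡ true
∨-true⁻ {true}  _ = inj₁ refl
∨-true⁻ {false} e = inj₂ e

∨-trueˡ : ∀ {a} b → a ≡ true → a ∨ b ≡ true
∨-trueˡ _ refl = refl

∨-trueʳ : ∀ a {b} → b ≡ true → a ∨ b ≡ true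
∨-trueʳ true  _ = refl
∨-trueʳ false e = e

∧-true⁻ : ∀ {a b} → a ∧ b ≡ true → a ≡ true × b ≡ true
∧-true⁻ {true} {true} _ = refl , refl

⌊⌋-true⁺ : ∀ {A : Set} (a? : Dec A) → A → ⌊ a? ⌋ ≡ true
⌊⌋-true⁺ a? a = trans (isYes≗does a?) (dec-true a? a)

⌊⌋-true⁻ : ∀ {A : Set} (a? : Dec A) → ⌊ a? ⌋ ≡ true → A
⌊⌋-true⁻ (yes a) _ = a

≡ᵇ-true⁻ : ∀ {m n} → (m ≡ᵇ n) ≡ true → m ≡ n
≡ᵇ-true⁻ {m} {n} e = ≡ᵇ⇒≡ m n (subst T (sym e) tt)

any-true⁻ : ∀ {A : Set} (P : A → Bool) xs → any P xs ≡ true → ∃[ x ] P x ≡ true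
any-true⁻ P (x ∷ xs) e with ∨-true⁻ {P x} e
... | inj₁ Px = x , Px
... | inj₂ Pxs = any-true⁻ P xs Pxs

all-true⁻ : ∀ {A : Set} (P : A → Bool) xs {x} → all P xs ≡ true → x ∈ xs → P x ≡ true
all-true⁻ P (y ∷ xs) e (here refl)  = proj₁ (∧-true⁻ e)
all-true⁻ P (y ∷ xs) e (there x∈xs) = all-true⁻ P xs (proj₂ (∧-true⁻ {P y} e)) x∈xs

any-true⁺ : ∀ {A : Set} (P : A → Bool) {x} xs → x ∈ xs → P x ≡ true → any P xs ≡ true
any-true⁺ P (y ∷ xs) (here refl) Px = ∨-trueˡ _ Px
any-true⁺ P (y ∷ xs) (there x∈xs) Px = ∨-trueʳ (P y) (any-true⁺ P xs x∈xs Px)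

module _ (G : FinGraph) where
  open FinGraph G

  Adjacent : V → V → Set
  Adjacent u v = adj u v ≡ true

  Move : V → V → Set
  Move u v = v ≡ u ⊎ Adjacent u v

  record IsGraphDistance (D : V → V → ℕ) : Set where
    field
      self≡0    : ∀ u → D u u ≡ 0
      ≡0⇒≡      : ∀ u v → D u v ≡ 0 → u ≡ v
      adj⇒≤suc  : ∀ u w v → Adjacent w v → D u v ≤ suc (D u w)
      descent   : ∀ u v → 0 < D u v → ∃[ w ] Adjacent w v × D u v ≡ suc (D u w)
      <size     : ∀ u v → D u v < length verts

  module _ {D : V → V → ℕ} (isD : IsGraphDistance D) (complete : ∀ v → v ∈ verts) where
    open IsGraphDistance isD

    reach⇒≤ : ∀ k u v → reach G k u v ≡ true → D u v ≤ k
    ≤⇒reach : ∀ k u v → D u v ≤ k → reach G k u v ≡ true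

    reach⇒≤ zero u v e rewrite ⌊⌋-true⁻ (u ≟V v) e = ≤-reflexive (self≡0 v)
    reach⇒≤ (suc k) u v e with ∨-true⁻ {reach G k u v} e
    ... | inj₁ r = m≤n⇒m≤1+n (reach⇒≤ k u v r)
    ... | inj₂ r with any-true⁻ (λ w → reach G k u w ∧ adj w v) verts r
    ...   | w , rw with ∧-true⁻ {reach G k u w} rw
    ...     | reach-w , w~v = ≤-trans (adj⇒≤suc u w v w~v) (s≤s (reach⇒≤ k u w reach-w))

    ≤⇒reach zero u v D≤0 = ⌊⌋-true⁺ (u ≟V v) (≡0⇒≡ u v (n≤0⇒n≡0 D≤0))
    ≤⇒reach (suc k) u v D≤1+k with m≤n⇒m<n∨m≡n D≤1+k
    ... | inj₁ D≤k = ∨-trueˡ _ (≤⇒reach k u v (≤-pred D≤k))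
    ... | inj₂ D≡1+k with descent u v (subst (0 <_) (sym D≡1+k) z<s)
    ...   | w , w~v , Dv≡1+Dw =
      ∨-trueʳ (reach G k u v)
        (any-true⁺ (λ w → reach G k u w ∧ adj w v) verts (complete w)
          (subst (λ b → b ∧ adj w v ≡ true)
                 (sym (≤⇒reach k u w (≤-reflexive (suc-injective (trans (sym Dv≡1+Dw) D≡1+k)))))
                 w~v))

    search≡ : ∀ fuel k u v → k ≤ D u v → D u v ≤ k + fuel → search G fuel k u v ≡ D u v
    search≡ zero k u v k≤D D≤k+0 = ≤-antisym k≤D (subst (D u v ≤_) (+-identityʳ k) D≤k+0)
    search≡ (suc fuel) k u v k≤D D≤k+1+f with reach G k u v in e
    ... | true  = ≤-antisym k≤D (reach⇒≤ k u v e)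
    ... | false with m≤n⇒m<n∨m≡n k≤D
    ...   | inj₁ k<D = search≡ fuel (suc k) u v k<D (subst (D u v ≤_) (+-suc k fuel) D≤k+1+f)
    ...   | inj₂ k≡D = contradiction (trans (sym (≤⇒reach k u v (≤-reflexive (sym k≡D)))) e) λ ()

    dist≡ : ∀ u v → dist G u v ≡ D u v
    dist≡ u v = search≡ (length verts) 0 u v z≤n (<⇒≤ (<size u v))

length-cartesianProduct : ∀ {A B : Set} (xs : List A) (ys : List B) →
                          length (cartesianProduct xs ys) ≡ length xs * length ys
length-cartesianProduct []       ys = refl
length-cartesianProduct (x ∷ xs) ys = begin
  length (map (x ,_) ys ++ cartesianProduct xs ys)       ≡⟨ length-++ (map (x ,_) ys) ⟩
  length (map (x ,_) ys) + length (cartesianProduct xs ys)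
    ≡⟨ cong₂ _+_ (length-map (x ,_) ys) (length-cartesianProduct xs ys) ⟩
  length ys + length xs * length ys                        ∎
  where open ≡-Reasoning

+-<-* : ∀ {a b m n} → a < m → b < n → a + b < m * n
+-<-* {a} {b} {suc i} {suc j} (s≤s a≤i) (s≤s b≤j) = s≤s (begin
  a + b              ≤⟨ +-mono-≤ a≤i b≤j ⟩
  i + j              ≤⟨ +-monoˡ-≤ j (m≤m*n i (suc j)) ⟩
  i * suc j + j      ≡⟨ +-comm (i * suc j) j ⟩
  j + i * suc j      ∎)
  where open ≤-Reasoning

module _ {G H : FinGraph} where
  private
    module G = FinGraph G
    module H = FinGraph H

  □-adj⁻ : ∀ {a b a' b'} → Adjacent (G □ H) (a , b) (a' , b') →
           (a ≡ a' × Adjacent H b b') ⊎ (b ≡ b' × Adjacent G a a')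
  □-adj⁻ {a} {b} {a'} {b'} e with ∨-true⁻ {⌊ a G.≟V a' ⌋ ∧ H.adj b b'} e
  ... | inj₁ e₁ = let (a≡a' , b~b') = ∧-true⁻ e₁ in inj₁ (⌊⌋-true⁻ (a G.≟V a') a≡a' , b~b')
  ... | inj₂ e₂ = let (b≡b' , a~a') = ∧-true⁻ e₂ in inj₂ (⌊⌋-true⁻ (b H.≟V b') b≡b' , a~a')

  □-adjʳ : ∀ a {b b'} → Adjacent H b b' → Adjacent (G □ H) (a , b) (a , b')
  □-adjʳ a b~b' rewrite ⌊⌋-true⁺ (a G.≟V a) refl = ∨-trueˡ _ b~b'

  □-adjˡ : ∀ {a a'} b → Adjacent G a a' → Adjacent (G □ H) (a , b) (a' , b)
  □-adjˡ {a} {a'} b a~a' rewrite ⌊⌋-true⁺ (b H.≟V b) refl = ∨-trueʳ (⌊ a G.≟V a' ⌋ ∧ H.adj b b) a~a'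

  □-complete : (∀ a → a ∈ G.verts) → (∀ b → b ∈ H.verts) → ∀ v → v ∈ FinGraph.verts (G □ H)
  □-complete completeG completeH (a , b) = ∈-cartesianProduct⁺ (completeG a) (completeH b)

  module _ {D : G.V → G.V → ℕ} {E : H.V → H.V → ℕ} where

    private
      _⊕_ : FinGraph.V (G □ H) → FinGraph.V (G □ H) → ℕ
      (a , b) ⊕ (c , d) = D a c + E b d

    □-isGraphDistance : IsGraphDistance G D → IsGraphDistance H E → IsGraphDistance (G □ H) _⊕_
    □-isGraphDistance isD isE = record
      { self≡0   = λ (a , b) → cong₂ _+_ (D.self≡0 a) (E.self≡0 b)
      ; ≡0⇒≡     = λ (a , b) (c , d) sum≡0 →
                     cong₂ _,_ (D.≡0⇒≡ a c (m+n≡0⇒m≡0 (D a c) sum≡0))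
                               (E.≡0⇒≡ b d (m+n≡0⇒n≡0 (D a c) sum≡0))
      ; adj⇒≤suc = adj⇒≤suc
      ; descent  = descent
      ; <size    = λ (a , b) (c , d) → subst (D a c + E b d <_)
                     (sym (length-cartesianProduct G.verts H.verts)) (+-<-* (D.<size a c) (E.<size b d))
      }
      where
        module D = IsGraphDistance isD
        module E = IsGraphDistance isE

        adj⇒≤suc : ∀ u w v → Adjacent (G □ H) w v → u ⊕ v ≤ suc (u ⊕ w)
        adj⇒≤suc (a , b) (c , d) (c' , d') w~v with □-adj⁻ {c} {d} {c'} {d'} w~v
        ... | inj₁ (refl , d~d') =
          ≤-trans (+-monoʳ-≤ (D a c) (E.adj⇒≤suc b d d' d~d')) (≤-reflexive (+-suc (D a c) (E b d)))
        ... | inj₂ (refl , c~c') = +-monoˡ-≤ (E b d) (D.adj⇒≤suc a c c' c~c')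

        descent : ∀ u v → 0 < u ⊕ v → ∃[ w ] Adjacent (G □ H) w v × u ⊕ v ≡ suc (u ⊕ w)
        descent (a , b) (c , d) pos with E b d in Ebd
        ... | suc k with E.descent b d (subst (0 <_) (sym Ebd) z<s)
        ...   | d' , d'~d , Ebd≡ = (c , d') , □-adjʳ c d'~d ,
                  trans (cong (D a c +_) (trans (sym Ebd) Ebd≡)) (+-suc (D a c) (E b d'))
        descent (a , b) (c , d) pos | zero with D.descent a c (subst (0 <_) (+-identityʳ (D a c)) pos)
        ...   | c' , c'~c , Dac≡ = (c' , d) , □-adjˡ d c'~c ,
                  trans (cong (_+ 0) Dac≡) (cong (suc (D a c') +_) (sym Ebd))

    dist-□ : IsGraphDistance G D → IsGraphDistance H E → (∀ a → a ∈ G.verts) → (∀ b → b ∈ H.verts) →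
             ∀ a b c d → dist (G □ H) (a , b) (c , d) ≡ D a c + E b d
    dist-□ isD isE completeG completeH a b c d =
      dist≡ (G □ H) (□-isGraphDistance isD isE) (□-complete completeG completeH) (a , b) (c , d)

OneApart : ℕ → ℕ → Set
OneApart m n = m ≡ suc n ⊎ n ≡ suc m

OneApart-sym : ∀ {m n} → OneApart m n → OneApart n m
OneApart-sym (inj₁ e) = inj₂ e
OneApart-sym (inj₂ e) = inj₁ e

OneApart⇒≤suc : ∀ {m n} → OneApart m n → m ≤ suc n
OneApart⇒≤suc (inj₁ refl) = ≤-refl
OneApart⇒≤suc (inj₂ refl) = m≤n⇒m≤1+n (n≤1+n _)

-- The distance between two vertices of C_{2h} whose indices differ by δ ≤ 2h.
arc : ℕ → ℕ → ℕ
arc h δ with δ ≤? h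
... | yes _ = δ
... | no  _ = h + h ∸ δ

module Arc (h : ℕ) where

  h≤2h∸δ : ∀ {δ} → δ ≤ h → h ≤ h + h ∸ δ
  h≤2h∸δ {δ} δ≤h = subst (_≤ h + h ∸ δ) (m+n∸n≡m h h) (∸-monoʳ-≤ (h + h) δ≤h)

  2h∸δ≤h : ∀ {δ} → h ≤ δ → h + h ∸ δ ≤ h
  2h∸δ≤h {δ} h≤δ = subst (h + h ∸ δ ≤_) (m+n∸n≡m h h) (∸-monoʳ-≤ (h + h) h≤δ)

  arc-≤ : ∀ {δ} → δ ≤ h → arc h δ ≡ δ
  arc-≤ {δ} δ≤h with δ ≤? h
  ... | yes _   = refl
  ... | no  δ≰h = contradiction δ≤h δ≰h

  arc-≥ : ∀ {δ} → h ≤ δ → arc h δ ≡ h + h ∸ δ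
  arc-≥ {δ} h≤δ with δ ≤? h
  ... | no  _   = refl
  ... | yes δ≤h with ≤-antisym δ≤h h≤δ
  ...   | refl  = sym (m+n∸n≡m h h)

  arc≤h : ∀ δ → arc h δ ≤ h
  arc≤h δ with δ ≤? h
  ... | yes δ≤h = δ≤h
  ... | no  δ≰h = 2h∸δ≤h (<⇒≤ (≰⇒> δ≰h))

  arc-reflect : ∀ {δ} → δ ≤ h + h → arc h (h + h ∸ δ) ≡ arc h δ
  arc-reflect {δ} δ≤2h with ≤-total δ h
  ... | inj₁ δ≤h = trans (arc-≥ (h≤2h∸δ δ≤h)) (trans (m∸[m∸n]≡n δ≤2h) (sym (arc-≤ δ≤h)))
  ... | inj₂ h≤δ = trans (arc-≤ (2h∸δ≤h h≤δ)) (sym (arc-≥ h≤δ))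

  arc≡0⇒≡0 : ∀ {δ} → δ < h + h → arc h δ ≡ 0 → δ ≡ 0
  arc≡0⇒≡0 {δ} δ<2h arc≡0 with δ ≤? h
  ... | yes _ = arc≡0
  ... | no  _ = contradiction (m∸n≡0⇒m≤n arc≡0) (<⇒≱ δ<2h)

  arc-suc-< : ∀ {δ} → δ < h → arc h (suc δ) ≡ suc (arc h δ)
  arc-suc-< δ<h = trans (arc-≤ δ<h) (cong suc (sym (arc-≤ (<⇒≤ δ<h))))

  arc-suc-≥ : ∀ {δ} → h ≤ δ → δ < h + h → arc h δ ≡ suc (arc h (suc δ))
  arc-suc-≥ h≤δ δ<2h =
    trans (arc-≥ h≤δ) (trans (+-∸-assoc 1 δ<2h) (cong suc (sym (arc-≥ (m≤n⇒m≤1+n h≤δ)))))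

  arc-oneApart : ∀ {δ} → δ < h + h → OneApart (arc h (suc δ)) (arc h δ)
  arc-oneApart {δ} δ<2h with ≤-total h δ
  ... | inj₁ h≤δ = inj₂ (arc-suc-≥ h≤δ δ<2h)
  ... | inj₂ δ≤h with m≤n⇒m<n∨m≡n δ≤h
  ...   | inj₁ δ<h = inj₁ (arc-suc-< δ<h)
  ...   | inj₂ refl = inj₂ (arc-suc-≥ ≤-refl δ<2h)

  private
    arc-suc-injective-mixed : ∀ {δ δ'} → δ ≤ h → h ≤ δ' → δ' < h + h →
                              arc h δ ≡ arc h δ' → arc h (suc δ) ≡ arc h (suc δ') → δ ≡ δ'
    arc-suc-injective-mixed {δ} {δ'} δ≤h h≤δ' δ'<2h e e-suc with m≤n⇒m<n∨m≡n δ≤h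
    ... | inj₁ δ<h = contradiction (begin
      δ                         ≡⟨ sym (arc-≤ δ≤h) ⟩
      arc h δ                   ≡⟨ e ⟩
      arc h δ'                  ≡⟨ arc-suc-≥ h≤δ' δ'<2h ⟩
      suc (arc h (suc δ'))      ≡⟨ cong suc (sym e-suc) ⟩
      suc (arc h (suc δ))       ≡⟨ cong suc (arc-≤ δ<h) ⟩
      suc (suc δ)               ∎)
      (λ δ≡2+δ → 1+n≰n (≤-trans (n≤1+n (suc δ)) (≤-reflexive (sym δ≡2+δ))))
      where open ≡-Reasoning
    ... | inj₂ refl = sym (begin
      δ'                        ≡⟨ sym (m∸[m∸n]≡n (<⇒≤ δ'<2h)) ⟩
      h + h ∸ (h + h ∸ δ')      ≡⟨ cong (h + h ∸_) (sym (arc-≥ h≤δ')) ⟩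
      h + h ∸ arc h δ'          ≡⟨ cong (h + h ∸_) (trans (sym e) (arc-≤ ≤-refl)) ⟩
      h + h ∸ h                 ≡⟨ m+n∸n≡m h h ⟩
      h                         ∎)
      where open ≡-Reasoning

  -- One probe cannot tell δ from 2h - δ; a second probe one step further along the cycle can.
  arc-suc-injective : ∀ {δ δ'} → δ < h + h → δ' < h + h →
                      arc h δ ≡ arc h δ' → arc h (suc δ) ≡ arc h (suc δ') → δ ≡ δ'
  arc-suc-injective {δ} {δ'} δ<2h δ'<2h e e-suc with ≤-total δ h | ≤-total δ' h
  ... | inj₁ δ≤h | inj₁ δ'≤h = trans (sym (arc-≤ δ≤h)) (trans e (arc-≤ δ'≤h))
  ... | inj₂ h≤δ | inj₂ h≤δ' =
    ∸-cancelˡ-≡ (<⇒≤ δ<2h) (<⇒≤ δ'<2h) (trans (sym (arc-≥ h≤δ)) (trans e (arc-≥ h≤δ')))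
  ... | inj₁ δ≤h | inj₂ h≤δ' = arc-suc-injective-mixed δ≤h h≤δ' δ'<2h e e-suc
  ... | inj₂ h≤δ | inj₁ δ'≤h = sym (arc-suc-injective-mixed δ'≤h h≤δ δ<2h (sym e) (sym e-suc))

[m%d+n]%d≡[m+n]%d : ∀ m n d .{{_ : NonZero d}} → (m % d + n) % d ≡ (m + n) % d
[m%d+n]%d≡[m+n]%d m n d = begin
  (m % d + n) % d            ≡⟨ %-distribˡ-+ (m % d) n d ⟩
  (m % d % d + n % d) % d    ≡⟨ cong (λ x → (x + n % d) % d) (m%n%n≡m%n m d) ⟩
  (m % d + n % d) % d        ≡⟨ sym (%-distribˡ-+ m n d) ⟩
  (m + n) % d                ∎
  where open ≡-Reasoning

[m+n%d]%d≡[m+n]%d : ∀ m n d .{{_ : NonZero d}} → (m + n % d) % d ≡ (m + n) % d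
[m+n%d]%d≡[m+n]%d m n d = begin
  (m + n % d) % d    ≡⟨ cong (_% d) (+-comm m (n % d)) ⟩
  (n % d + m) % d    ≡⟨ [m%d+n]%d≡[m+n]%d n m d ⟩
  (n + m) % d        ≡⟨ cong (_% d) (+-comm n m) ⟩
  (m + n) % d        ∎
  where open ≡-Reasoning

suc%-cases : ∀ {m d} .{{_ : NonZero d}} → suc m ≤ d → suc m % d ≡ suc m ⊎ (suc m % d ≡ 0 × suc m ≡ d)
suc%-cases 1+m≤d with m≤n⇒m<n∨m≡n 1+m≤d
... | inj₁ 1+m<d = inj₁ (m<n⇒m%n≡m 1+m<d)
... | inj₂ refl  = inj₂ (n%n≡0 _ , refl)

module EvenCycle (n h : ℕ) (order : suc n ≡ h + h) where

  open Arc h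

  Vertex : Set
  Vertex = Fin (suc n)

  up : Vertex → Vertex
  up x = fromℕ< (m%n<n (suc (toℕ x)) (suc n))

  down : Vertex → Vertex
  down x = fromℕ< (m%n<n (toℕ x + n) (suc n))

  toℕ-up : ∀ x → toℕ (up x) ≡ suc (toℕ x) % suc n
  toℕ-up x = toℕ-fromℕ< _

  up-down : ∀ x → up (down x) ≡ x
  up-down x = toℕ-injective (begin
    toℕ (up (down x))                ≡⟨ toℕ-up (down x) ⟩
    suc (toℕ (down x)) % suc n       ≡⟨ cong (λ y → suc y % suc n) (toℕ-fromℕ< _) ⟩
    (1 + (X + n) % suc n) % suc n    ≡⟨ [m+n%d]%d≡[m+n]%d 1 (X + n) (suc n) ⟩
    suc (X + n) % suc n              ≡⟨ cong (_% suc n) (sym (+-suc X n)) ⟩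
    (X + suc n) % suc n              ≡⟨ [m+n]%n≡m%n X (suc n) ⟩
    X % suc n                        ≡⟨ m<n⇒m%n≡m (toℕ<n x) ⟩
    X                                ∎)
    where open ≡-Reasoning
          X = toℕ x

  Neighbours : Vertex → Vertex → Set
  Neighbours x y = y ≡ up x ⊎ x ≡ up y

  -- The offset from c to x along the direction of up; distance x c is its arc.
  offset : Vertex → Vertex → ℕ
  offset x c = (toℕ x + (suc n ∸ toℕ c)) % suc n

  offset-up : ∀ x c → offset (up x) c ≡ suc (offset x c) % suc n
  offset-up x c = begin
    (toℕ (up x) + K) % suc n              ≡⟨ cong (λ y → (y + K) % suc n) (toℕ-up x) ⟩
    (suc (toℕ x) % suc n + K) % suc n     ≡⟨ [m%d+n]%d≡[m+n]%d (suc (toℕ x)) K (suc n) ⟩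
    suc (toℕ x + K) % suc n               ≡⟨ sym ([m+n%d]%d≡[m+n]%d 1 (toℕ x + K) (suc n)) ⟩
    suc (offset x c) % suc n              ∎
    where open ≡-Reasoning
          K = suc n ∸ toℕ c

  distance : Vertex → Vertex → ℕ
  distance x c = arc h ∣ toℕ x - toℕ c ∣

  distance-comm : ∀ x c → distance x c ≡ distance c x
  distance-comm x c = cong (arc h) (∣-∣-comm (toℕ x) (toℕ c))

  offset<order : ∀ x c → offset x c < suc n
  offset<order x c = m%n<n (toℕ x + (suc n ∸ toℕ c)) (suc n)

  offset<2h : ∀ x c → offset x c < h + h
  offset<2h x c = subst (offset x c <_) order (offset<order x c)

  distance≡arc-offset : ∀ x c → distance x c ≡ arc h (offset x c)
  distance≡arc-offset x c with toℕ c ≤? toℕ x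
  ... | yes C≤X = cong (arc h) (begin
    ∣ X - C ∣                  ≡⟨ m≤n⇒∣n-m∣≡n∸m C≤X ⟩
    X ∸ C                      ≡⟨ sym (m<n⇒m%n≡m (≤-<-trans (m∸n≤m X C) (toℕ<n x))) ⟩
    (X ∸ C) % suc n            ≡⟨ sym ([m+n]%n≡m%n (X ∸ C) (suc n)) ⟩
    (X ∸ C + suc n) % suc n    ≡⟨ cong (_% suc n) (sym (+-∸-comm (suc n) C≤X)) ⟩
    (X + suc n ∸ C) % suc n    ≡⟨ cong (_% suc n) (+-∸-assoc X C≤M) ⟩
    offset x c                 ∎)
    where open ≡-Reasoning
          X = toℕ x
          C = toℕ c
          C≤M = <⇒≤ (toℕ<n c)
  ... | no C≰X = begin
    arc h ∣ X - C ∣                      ≡⟨ cong (arc h) (m≤n⇒∣m-n∣≡n∸m X≤C) ⟩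
    arc h (C ∸ X)                        ≡⟨ sym (arc-reflect (subst (C ∸ X ≤_) order C∸X≤M)) ⟩
    arc h (h + h ∸ (C ∸ X))              ≡⟨ cong (λ m → arc h (m ∸ (C ∸ X))) (sym order) ⟩
    arc h (suc n ∸ (C ∸ X))              ≡⟨ cong (arc h) (sym (m<n⇒m%n≡m M∸[C∸X]<M)) ⟩
    arc h ((suc n ∸ (C ∸ X)) % suc n)    ≡⟨ cong (λ m → arc h (m % suc n)) wrap ⟩
    arc h (offset x c)                   ∎
    where open ≡-Reasoning
          X = toℕ x
          C = toℕ c
          X≤C = <⇒≤ (≰⇒> C≰X)
          C≤M = <⇒≤ (toℕ<n c)
          C∸X≤M = ≤-trans (m∸n≤m C X) C≤M
          M∸[C∸X]<M : suc n ∸ (C ∸ X) < suc n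
          M∸[C∸X]<M = ∸-monoʳ-< (m<n⇒0<n∸m (≰⇒> C≰X)) C∸X≤M
          wrap : suc n ∸ (C ∸ X) ≡ X + (suc n ∸ C)
          wrap = begin
            suc n ∸ (C ∸ X)                  ≡⟨ cong (_∸ (C ∸ X)) (sym (m∸n+n≡m C≤M)) ⟩
            (suc n ∸ C) + C ∸ (C ∸ X)        ≡⟨ +-∸-assoc (suc n ∸ C) (m∸n≤m C X) ⟩
            (suc n ∸ C) + (C ∸ (C ∸ X))      ≡⟨ cong ((suc n ∸ C) +_) (m∸[m∸n]≡n X≤C) ⟩
            (suc n ∸ C) + X                  ≡⟨ +-comm (suc n ∸ C) X ⟩
            X + (suc n ∸ C)                  ∎

  arc-suc% : ∀ {δ} → δ < suc n → arc h (suc δ % suc n) ≡ arc h (suc δ)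
  arc-suc% δ<M with suc%-cases δ<M
  ... | inj₁ noWrap       = cong (arc h) noWrap
  ... | inj₂ (wraps , e)  =
    trans (cong (arc h) wraps) (trans (sym (arc-reflect z≤n)) (cong (arc h) (trans (sym order) (sym e))))

  distance-up : ∀ x c → distance (up x) c ≡ arc h (suc (offset x c))
  distance-up x c = begin
    distance (up x) c                        ≡⟨ distance≡arc-offset (up x) c ⟩
    arc h (offset (up x) c)            ≡⟨ cong (arc h) (offset-up x c) ⟩
    arc h (suc (offset x c) % suc n)   ≡⟨ arc-suc% (offset<order x c) ⟩
    arc h (suc (offset x c))           ∎
    where open ≡-Reasoning

  neighbours-oneApart : ∀ {x y} c → Neighbours x y → OneApart (distance y c) (distance x c)
  neighbours-oneApart {x} c (inj₁ refl) =
    subst₂ OneApart (sym (distance-up x c)) (sym (distance≡arc-offset x c)) (arc-oneApart (offset<2h x c))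
  neighbours-oneApart {y = y} c (inj₂ refl) = OneApart-sym (neighbours-oneApart c (inj₁ refl))

  distance-descent : ∀ x c → 0 < distance x c → ∃[ y ] Neighbours y x × distance x c ≡ suc (distance y c)
  distance-descent x c pos with ≤-total (offset x c) h
  ... | inj₂ h≤δ = up x , inj₂ refl , (begin
    distance x c                     ≡⟨ distance≡arc-offset x c ⟩
    arc h (offset x c)         ≡⟨ arc-suc-≥ h≤δ (offset<2h x c) ⟩
    suc (arc h (suc (offset x c))) ≡⟨ cong suc (sym (distance-up x c)) ⟩
    suc (distance (up x) c)          ∎)
    where open ≡-Reasoning
  ... | inj₁ δ≤h with suc%-cases (offset<order (down x) c)
  ...   | inj₂ (wraps , _) = contradiction (begin
    distance x c                                    ≡⟨ distance≡arc-offset x c ⟩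
    arc h (offset x c)                        ≡⟨ cong (arc h) δ≡ ⟩
    arc h (suc (offset (down x) c) % suc n)   ≡⟨ cong (arc h) wraps ⟩
    arc h 0                                   ≡⟨ arc-≤ z≤n ⟩
    0                                         ∎) (>⇒≢ pos)
    where open ≡-Reasoning
          δ≡ : offset x c ≡ suc (offset (down x) c) % suc n
          δ≡ = trans (cong (λ z → offset z c) (sym (up-down x))) (offset-up (down x) c)
  ...   | inj₁ noWrap = down x , inj₁ (sym (up-down x)) , (begin
    distance x c                          ≡⟨ distance≡arc-offset x c ⟩
    arc h (offset x c)              ≡⟨ cong (arc h) δ≡ ⟩
    arc h (suc δ')                  ≡⟨ arc-suc-< (subst (_≤ h) δ≡ δ≤h) ⟩
    suc (arc h δ')                  ≡⟨ cong suc (sym (distance≡arc-offset (down x) c)) ⟩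
    suc (distance (down x) c)             ∎)
    where open ≡-Reasoning
          δ' = offset (down x) c
          δ≡ : offset x c ≡ suc δ'
          δ≡ = trans (cong (λ z → offset z c) (sym (up-down x))) (trans (offset-up (down x) c) noWrap)

  distance-self : ∀ x → distance x x ≡ 0
  distance-self x = trans (cong (arc h) (∣n-n∣≡0 (toℕ x))) (arc-≤ z≤n)

  distance≡0⇒≡ : ∀ x c → distance x c ≡ 0 → x ≡ c
  distance≡0⇒≡ x c distance≡0 = toℕ-injective (∣m-n∣≡0⇒m≡n (arc≡0⇒≡0 ∣X-C∣<2h distance≡0))
    where ∣X-C∣<2h : ∣ toℕ x - toℕ c ∣ < h + h
          ∣X-C∣<2h = subst (∣ toℕ x - toℕ c ∣ <_) order
                       (≤-<-trans (∣m-n∣≤m⊔n (toℕ x) (toℕ c)) (⊔-lub (toℕ<n x) (toℕ<n c)))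

  h<order : h < suc n
  h<order = subst (h <_) (sym order) (m<m+n h (n≢0⇒n>0 h≢0))
    where h≢0 : h ≢ 0
          h≢0 refl = contradiction order λ ()

  private
    -- The test by which cycleAdj recognises j as the successor of i.
    Successor : Vertex → Vertex → Bool
    Successor i j = ⌊ toℕ j ≟ suc (toℕ i) ⌋ ∨ (⌊ suc (toℕ i) ≟ suc n ⌋ ∧ ⌊ toℕ j ≟ 0 ⌋)

    successor-sound : ∀ i j → Successor i j ≡ true → j ≡ up i
    successor-sound i j e with ∨-true⁻ {⌊ toℕ j ≟ suc (toℕ i) ⌋} e
    ... | inj₁ e₁ = toℕ-injective (trans J≡1+I (sym (trans (toℕ-up i) (m<n⇒m%n≡m 1+I<M))))
      where J≡1+I = ⌊⌋-true⁻ (toℕ j ≟ suc (toℕ i)) e₁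
            1+I<M = subst (_< suc n) J≡1+I (toℕ<n j)
    ... | inj₂ e₂ with ∧-true⁻ e₂
    ...   | e₃ , e₄ = toℕ-injective (trans (⌊⌋-true⁻ (toℕ j ≟ 0) e₄) (sym (begin
      toℕ (up i)              ≡⟨ toℕ-up i ⟩
      suc (toℕ i) % suc n     ≡⟨ cong (_% suc n) (⌊⌋-true⁻ (suc (toℕ i) ≟ suc n) e₃) ⟩
      suc n % suc n           ≡⟨ n%n≡0 (suc n) ⟩
      0                       ∎)))
      where open ≡-Reasoning

    successor-up : ∀ i → Successor i (up i) ≡ true
    successor-up i with suc%-cases (toℕ<n i)
    ... | inj₁ noWrap = ∨-trueˡ _ (⌊⌋-true⁺ (toℕ (up i) ≟ suc (toℕ i)) (trans (toℕ-up i) noWrap))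
    ... | inj₂ (wraps , 1+I≡M) = ∨-trueʳ ⌊ toℕ (up i) ≟ suc (toℕ i) ⌋
      (subst₂ (λ a b → a ∧ b ≡ true)
        (sym (⌊⌋-true⁺ (suc (toℕ i) ≟ suc n) 1+I≡M))
        (sym (⌊⌋-true⁺ (toℕ (up i) ≟ 0) (trans (toℕ-up i) wraps))) refl)

  adj⇒neighbours : ∀ x y → cycleAdj (suc n) x y ≡ true → Neighbours x y
  adj⇒neighbours x y e with ∨-true⁻ {Successor x y} e
  ... | inj₁ x→y = inj₁ (successor-sound x y x→y)
  ... | inj₂ y→x = inj₂ (successor-sound y x y→x)

  neighbours⇒adj : ∀ {x y} → Neighbours x y → cycleAdj (suc n) x y ≡ true
  neighbours⇒adj {x} (inj₁ refl) = ∨-trueˡ _ (successor-up x)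
  neighbours⇒adj {y = y} (inj₂ refl) = ∨-trueʳ (Successor (up y) y) (successor-up y)

  cycle-isGraphDistance : IsGraphDistance (Cycle (suc n)) distance
  cycle-isGraphDistance = record
    { self≡0   = distance-self
    ; ≡0⇒≡     = distance≡0⇒≡
    ; adj⇒≤suc = λ u w v w~v → subst₂ _≤_ (distance-comm v u) (cong suc (distance-comm w u))
                   (OneApart⇒≤suc (neighbours-oneApart u (adj⇒neighbours w v w~v)))
    ; descent  = descent
    ; <size    = λ u v → subst (distance u v <_) (sym (length-tabulate {n = suc n} (λ i → i)))
                   (≤-<-trans (arc≤h ∣ toℕ u - toℕ v ∣) h<order)
    }
    where
      descent : ∀ u v → 0 < distance u v →
                ∃[ w ] Adjacent (Cycle (suc n)) w v × distance u v ≡ suc (distance u w)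
      descent u v pos with distance-descent v u (subst (0 <_) (distance-comm u v) pos)
      ... | w , w~v , e = w , neighbours⇒adj w~v , trans (distance-comm u v) (trans e (cong suc (distance-comm w u)))

  distance-zero : ∀ y → distance y zero ≡ arc h (toℕ y)
  distance-zero y = cong (arc h) (∣-∣-identityʳ (toℕ y))

  distance-last : ∀ y → distance y (fromℕ n) ≡ arc h (suc (toℕ y))
  distance-last y = begin
    arc h ∣ toℕ y - toℕ (fromℕ n) ∣  ≡⟨ cong (λ m → arc h ∣ toℕ y - m ∣) (toℕ-fromℕ n) ⟩
    arc h ∣ toℕ y - n ∣              ≡⟨ cong (arc h) (m≤n⇒∣m-n∣≡n∸m (≤-pred (toℕ<n y))) ⟩
    arc h (suc n ∸ suc (toℕ y))      ≡⟨ cong (λ m → arc h (m ∸ suc (toℕ y))) order ⟩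
    arc h (h + h ∸ suc (toℕ y))      ≡⟨ arc-reflect (subst (suc (toℕ y) ≤_) order (toℕ<n y)) ⟩
    arc h (suc (toℕ y))              ∎
    where open ≡-Reasoning

  located-by-zero-and-last : ∀ y y' → distance y zero ≡ distance y' zero →
                             distance y (fromℕ n) ≡ distance y' (fromℕ n) → y ≡ y'
  located-by-zero-and-last y y' e e-last = toℕ-injective (arc-suc-injective
    (subst (toℕ y <_) order (toℕ<n y)) (subst (toℕ y' <_) order (toℕ<n y'))
    (trans (sym (distance-zero y)) (trans e (distance-zero y')))
    (trans (sym (distance-last y)) (trans e-last (distance-last y'))))

module _ (G : FinGraph) (k : ℕ) where
  open FinGraph G

  -- A Robber strategy that keeps two distinct walks consistent with every answer.
  record TwinEvasion : Set₁ where
    field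
      State        : Set
      start        : State
      left right   : State → V
      distinct     : ∀ s → right s ≢ left s
      next         : State → Vec V k → State
      left-moves   : ∀ s B → Move G (left s) (left (next s B))
      right-moves  : ∀ s B → Move G (right s) (right (next s B))
      same-answers : ∀ s B → mapᵥ (dist G (left (next s B))) B ≡ mapᵥ (dist G (right (next s B))) B

  module Play (E : TwinEvasion) (σ : Strategy G k) where
    open TwinEvasion E

    -- The Robber may fix its whole walk in advance, since it knows σ.
    mutual
      states : ℕ → State
      states zero    = next start (σ [])
      states (suc t) = next (states t) (σ (answers (suc t)))

      answers : ℕ → List (Vec ℕ k)
      answers zero    = []
      answers (suc t) = mapᵥ (dist G (left (states t))) (σ (answers t)) ∷ answers t

    left-walk : IsRobberWalk G (left ∘ states)
    left-walk t = left-moves (states t) (σ (answers (suc t)))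

    right-walk : IsRobberWalk G (right ∘ states)
    right-walk t = right-moves (states t) (σ (answers (suc t)))

    same-answers-at : ∀ t → mapᵥ (dist G (left (states t))) (σ (answers t)) ≡
                            mapᵥ (dist G (right (states t))) (σ (answers t))
    same-answers-at zero    = same-answers start (σ [])
    same-answers-at (suc t) = same-answers (states t) (σ (answers (suc t)))

    history-left : ∀ t → history G σ (left ∘ states) t ≡ answers t
    history-left zero    = refl
    history-left (suc t) =
      cong₂ _∷_ (cong (λ A → mapᵥ (dist G (left (states t))) (σ A)) (history-left t)) (history-left t)

    history-right : ∀ t → history G σ (right ∘ states) t ≡ answers t
    history-right zero    = refl
    history-right (suc t) =
      cong₂ _∷_ (trans (cong (λ A → mapᵥ (dist G (right (states t))) (σ A)) (history-right t))
                       (sym (same-answers-at t)))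
                (history-right t)

  twinEvasion⇒¬CopWins : TwinEvasion → ¬ CopWins G k
  twinEvasion⇒¬CopWins E (σ , wins) =
    distinct (states t)
      (located (right ∘ states) right-walk (trans (history-right (suc t)) (sym (history-left (suc t)))))
    where
      open TwinEvasion E
      open Play E σ
      t = proj₁ (wins (left ∘ states) left-walk)
      located = proj₂ (wins (left ∘ states) left-walk)

module _ (G : FinGraph) where

  -- An extra cop can duplicate the probe of the first one.
  CopWins-suc : ∀ {k} → CopWins G (suc k) → CopWins G (suc (suc k))
  CopWins-suc {k} (σ , wins) = σ' , λ r walk →
    let (t , located) = wins r walk in
    t , λ r' walk' same →
      located r' walk' (trans (sym (forget r' (suc t))) (trans (cong (map tail) same) (forget r (suc t))))
    where
      σ' : Strategy G (suc (suc k))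
      σ' H = let B = σ (map tail H) in head B ∷ B

      forget : ∀ r t → map tail (history G σ' r t) ≡ history G σ r t
      forget r zero    = refl
      forget r (suc t) = cong₂ _∷_ (cong (λ H → mapᵥ (dist G (r t)) (σ H)) (forget r t)) (forget r t)

+-cross : ∀ {y y' a a' b b'} → y + a ≡ y' + a' → y + b ≡ y' + b' → a + b' ≡ a' + b
+-cross {y} {y'} {a} {a'} {b} {b'} e₁ e₂ = +-cancelˡ-≡ (y + y') (a + b') (a' + b) (begin
  (y + y') + (a + b')    ≡⟨ interchange y y' a b' ⟩
  (y + a) + (y' + b')    ≡⟨ cong₂ _+_ e₁ (sym e₂) ⟩
  (y' + a') + (y + b)    ≡⟨ interchange y' a' y b ⟩
  (y' + y) + (a' + b)    ≡⟨ cong (_+ (a' + b)) (+-comm y' y) ⟩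
  (y + y') + (a' + b)    ∎)
  where open ≡-Reasoning

+-<ᵇ-cancelˡ : ∀ x a b → (x + a <ᵇ x + b) ≡ (a <ᵇ b)
+-<ᵇ-cancelˡ zero    a b = refl
+-<ᵇ-cancelˡ (suc x) a b = +-<ᵇ-cancelˡ x a b

module C₄ = EvenCycle 3 2 refl

Near : Fin 4 → Fin 4 → Set
Near β c = c ≡ β ⊎ C₄.Neighbours β c

near? : ∀ β c → Dec (Near β c)
near? β c = (c ≟ᶠ β) ⊎-dec (c ≟ᶠ C₄.up β) ⊎-dec (β ≟ᶠ C₄.up c)

-- The row of the robber after a move is one of three rows adjacent to β, and the
-- difference of its distances to the rows just above and below β tells which.
row-determined : ∀ β c c' → Near β c → Near β c' →
                 C₄.distance c (C₄.up β) + C₄.distance c' (C₄.down β) ≡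
                 C₄.distance c' (C₄.up β) + C₄.distance c (C₄.down β) →
                 c ≡ c'
row-determined = from-yes (all? {n = 4} λ β → all? {n = 4} λ c → all? {n = 4} λ c' →
  near? β c →-dec near? β c' →-dec
    (C₄.distance c (C₄.up β) + C₄.distance c' (C₄.down β) ≟
     C₄.distance c' (C₄.up β) + C₄.distance c (C₄.down β)) →-dec
    (c ≟ᶠ c'))

decodeRow : Vec ℕ 3 → Fin 4
decodeRow (d₀ ∷ d₁ ∷ d₂ ∷ []) =
  if d₀ <ᵇ d₂ then zero
  else if d₂ <ᵇ d₀ then suc (suc zero)
  else if d₁ <ᵇ d₀ then suc zero
  else suc (suc (suc zero))

decodeRow-+ : ∀ x a b c → decodeRow (x + a ∷ x + b ∷ x + c ∷ []) ≡ decodeRow (a ∷ b ∷ c ∷ [])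
decodeRow-+ x a b c rewrite +-<ᵇ-cancelˡ x a c | +-<ᵇ-cancelˡ x c a | +-<ᵇ-cancelˡ x b a = refl

decodeRow-rows : ∀ b →
  decodeRow (C₄.distance b zero ∷ C₄.distance b (suc zero) ∷ C₄.distance b (suc (suc zero)) ∷ []) ≡ b
decodeRow-rows zero                   = refl
decodeRow-rows (suc zero)             = refl
decodeRow-rows (suc (suc zero))       = refl
decodeRow-rows (suc (suc (suc zero))) = refl

-- A strategy for the robber against two cops, up to translation

data Offset : Set where
  o₋₁ o₀ o₁ o₂ : Offset

data Lane : Set where
  baseColumn nextColumn : Lane

data Shape : Set where
  vertical upRight downRight upLeft downLeft : Shape

data Shift : Set where
  back stay forward : Shift

Increments : Set
Increments = Bool × Bool × Bool

AbstractVertex : Set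
AbstractVertex = Offset × Fin 4

AbstractProbe : Set
AbstractProbe = Increments × Fin 4

rotations-move : ∀ b → C₄.up b ≢ b × C₄.down b ≢ b × C₄.up (C₄.up b) ≢ b
rotations-move = from-yes (all? {n = 4} λ b →
  ¬? (C₄.up b ≟ᶠ b) ×-dec ¬? (C₄.down b ≟ᶠ b) ×-dec ¬? (C₄.up (C₄.up b) ≟ᶠ b))

-- Twin robbers U and W relative to a base column, W being located by the shape:
-- two rows above U, or diagonally next to U.
twinU twinW : Shape → Fin 4 → Lane × Fin 4
twinU vertical  b = baseColumn , b
twinU upRight   b = baseColumn , b
twinU downRight b = baseColumn , b
twinU upLeft    b = nextColumn , b
twinU downLeft  b = nextColumn , b
twinW vertical  b = baseColumn , C₄.up (C₄.up b)
twinW upRight   b = nextColumn , C₄.up b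
twinW downRight b = nextColumn , C₄.down b
twinW upLeft    b = baseColumn , C₄.up b
twinW downLeft  b = baseColumn , C₄.down b

twin-rows-differ : ∀ s b → proj₂ (twinW s b) ≢ proj₂ (twinU s b)
twin-rows-differ vertical  b = proj₂ (proj₂ (rotations-move b))
twin-rows-differ upRight   b = proj₁ (rotations-move b)
twin-rows-differ downRight b = proj₁ (proj₂ (rotations-move b))
twin-rows-differ upLeft    b = proj₁ (rotations-move b)
twin-rows-differ downLeft  b = proj₁ (proj₂ (rotations-move b))

shifted : Shift → Lane → Offset
shifted back    baseColumn = o₋₁
shifted back    nextColumn = o₀
shifted stay    baseColumn = o₀
shifted stay    nextColumn = o₁
shifted forward baseColumn = o₁
shifted forward nextColumn = o₂

place : Shift → Lane × Fin 4 → AbstractVertex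
place sh (l , b) = shifted sh l , b

-- 2 + d(column a+o, c) − d(column a, c) for a cop in column c, given for each of the
-- steps a−1 → a → a+1 → a+2 whether it increases the distance to c.
columnExcess : Increments → Offset → ℕ
columnExcess (i₁ , _)       o₋₁ = if i₁ then 1 else 3
columnExcess _              o₀  = 2
columnExcess (_ , i₂ , _)   o₁  = if i₂ then 3 else 1
columnExcess (_ , i₂ , i₃)  o₂  = if i₂ then (if i₃ then 4 else 2) else (if i₃ then 2 else 0)

increased : ∀ {m n} → OneApart m n → Bool
increased (inj₁ _) = true
increased (inj₂ _) = false

excess-back : ∀ {m n} (st : OneApart m n) → n + 2 ≡ m + (if increased st then 1 else 3)
excess-back {n = n} (inj₁ refl) = +-suc n 1
excess-back {m}     (inj₂ refl) = sym (+-suc m 2)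

excess-forward : ∀ {m n} (st : OneApart m n) → m + 2 ≡ n + (if increased st then 3 else 1)
excess-forward {n = n} (inj₁ refl) = sym (+-suc n 2)
excess-forward {m}     (inj₂ refl) = +-suc m 1

excess-forward² : ∀ {k m n} (st : OneApart m n) (st' : OneApart k m) →
                  k + 2 ≡ n + (if increased st then (if increased st' then 4 else 2)
                                              else (if increased st' then 2 else 0))
excess-forward² {n = n} (inj₁ refl) (inj₁ refl) = sym (trans (+-suc n 3) (cong suc (+-suc n 2)))
excess-forward²         (inj₁ refl) (inj₂ refl) = refl
excess-forward²         (inj₂ refl) (inj₁ refl) = refl
excess-forward² {k}     (inj₂ refl) (inj₂ refl) = trans (+-comm k 2) (sym (+-identityʳ (2 + k)))

excess : AbstractProbe → AbstractVertex → ℕ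
excess (π , c) (o , b) = columnExcess π o + C₄.distance b c

abstractMove : AbstractVertex → AbstractVertex → Bool
abstractMove (o₋₁ , b) (o₋₁ , b') = ⌊ near? b b' ⌋
abstractMove (o₀  , b) (o₀  , b') = ⌊ near? b b' ⌋
abstractMove (o₁  , b) (o₁  , b') = ⌊ near? b b' ⌋
abstractMove (o₂  , b) (o₂  , b') = ⌊ near? b b' ⌋
abstractMove (o₋₁ , b) (o₀  , b') = ⌊ b ≟ᶠ b' ⌋
abstractMove (o₀  , b) (o₁  , b') = ⌊ b ≟ᶠ b' ⌋
abstractMove (o₁  , b) (o₂  , b') = ⌊ b ≟ᶠ b' ⌋
abstractMove (o₀  , b) (o₋₁ , b') = ⌊ b ≟ᶠ b' ⌋
abstractMove (o₁  , b) (o₀  , b') = ⌊ b ≟ᶠ b' ⌋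
abstractMove (o₂  , b) (o₁  , b') = ⌊ b ≟ᶠ b' ⌋
abstractMove _         _          = false

Reply : Set
Reply = Shape × Fin 4 × Shift

valid : Shape → Fin 4 → AbstractProbe → AbstractProbe → Reply → Bool
valid s b π₁ π₂ (s' , b' , sh) =
  abstractMove (place stay (twinU s b)) U' ∧ abstractMove (place stay (twinW s b)) W' ∧
  (excess π₁ U' ≡ᵇ excess π₁ W') ∧ (excess π₂ U' ≡ᵇ excess π₂ W')
  where
    U' = place sh (twinU s' b')
    W' = place sh (twinW s' b')

valid⁻ : ∀ s b π₁ π₂ s' b' sh → valid s b π₁ π₂ (s' , b' , sh) ≡ true →
         abstractMove (place stay (twinU s b)) (place sh (twinU s' b')) ≡ true ×
         abstractMove (place stay (twinW s b)) (place sh (twinW s' b')) ≡ true ×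
         excess π₁ (place sh (twinU s' b')) ≡ excess π₁ (place sh (twinW s' b')) ×
         excess π₂ (place sh (twinU s' b')) ≡ excess π₂ (place sh (twinW s' b'))
valid⁻ s b π₁ π₂ s' b' sh ok with ∧-true⁻ ok
... | moveU , ok₁ with ∧-true⁻ ok₁
...   | moveW , ok₂ with ∧-true⁻ ok₂
...     | same₁ , same₂ = moveU , moveW , ≡ᵇ-true⁻ same₁ , ≡ᵇ-true⁻ same₂

-- Replies found by exhaustive search; it suffices to try these.
candidates : Shape → Fin 4 → List Reply
candidates vertical b =
  (vertical , b , back) ∷ (vertical , C₄.up b , stay) ∷ (vertical , C₄.down b , stay) ∷
  (upRight , b , back) ∷ (upRight , C₄.up b , stay) ∷
  (downRight , b , back) ∷ (downRight , C₄.down b , stay) ∷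
  (upLeft , b , stay) ∷ (upLeft , C₄.up b , back) ∷ (downLeft , b , stay) ∷ (downLeft , C₄.down b , back) ∷ []
candidates upRight b =
  (vertical , b , forward) ∷ (vertical , C₄.down b , stay) ∷ (upRight , b , stay) ∷ (upRight , b , back) ∷
  (upRight , C₄.up b , stay) ∷ (upRight , C₄.down b , stay) ∷ (downRight , C₄.up b , stay) ∷ []
candidates downRight b =
  (vertical , b , forward) ∷ (vertical , C₄.up b , stay) ∷ (upRight , C₄.up b , stay) ∷
  (upRight , C₄.down b , stay) ∷ (downRight , C₄.up b , stay) ∷ (downRight , C₄.down b , stay) ∷ []
candidates upLeft b =
  (vertical , b , stay) ∷ (vertical , C₄.down b , forward) ∷ (upRight , b , stay) ∷
  (upLeft , b , stay) ∷ (upLeft , C₄.up b , stay) ∷ (upLeft , C₄.down b , stay) ∷ []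
candidates downLeft b =
  (vertical , b , stay) ∷ (vertical , C₄.up b , forward) ∷ (downRight , b , stay) ∷
  (upLeft , C₄.up b , stay) ∷ (downLeft , C₄.up b , stay) ∷ (downLeft , C₄.down b , stay) ∷ []

shapes : List Shape
shapes = vertical ∷ upRight ∷ downRight ∷ upLeft ∷ downLeft ∷ []

bools : List Bool
bools = true ∷ false ∷ []

probes : List AbstractProbe
probes = cartesianProduct (cartesianProduct bools (cartesianProduct bools bools)) (allFin 4)

situations : List (Shape × Fin 4 × AbstractProbe × AbstractProbe)
situations = cartesianProduct shapes (cartesianProduct (allFin 4) (cartesianProduct probes probes))

situations-complete : ∀ x → x ∈ situations
situations-complete (s , b , ((i₁ , i₂ , i₃) , c₁) , ((j₁ , j₂ , j₃) , c₂)) =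
  ∈-cartesianProduct⁺ (shape∈ s) (∈-cartesianProduct⁺ (∈-allFin b)
    (∈-cartesianProduct⁺ (probe∈ i₁ i₂ i₃ c₁) (probe∈ j₁ j₂ j₃ c₂)))
  where
    bool∈ : ∀ x → x ∈ bools
    bool∈ true  = here refl
    bool∈ false = there (here refl)
    shape∈ : ∀ s → s ∈ shapes
    shape∈ vertical  = here refl
    shape∈ upRight   = there (here refl)
    shape∈ downRight = there (there (here refl))
    shape∈ upLeft    = there (there (there (here refl)))
    shape∈ downLeft  = there (there (there (there (here refl))))
    probe∈ : ∀ i₁ i₂ i₃ c → ((i₁ , i₂ , i₃) , c) ∈ probes
    probe∈ i₁ i₂ i₃ c =
      ∈-cartesianProduct⁺ (∈-cartesianProduct⁺ (bool∈ i₁) (∈-cartesianProduct⁺ (bool∈ i₂) (bool∈ i₃))) (∈-allFin c)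

all-valid : all (λ (s , b , π₁ , π₂) → any (valid s b π₁ π₂) (candidates s b)) situations ≡ true
all-valid = refl

reply : ∀ s b π₁ π₂ → ∃[ r ] valid s b π₁ π₂ r ≡ true
reply s b π₁ π₂ = any-true⁻ (valid s b π₁ π₂) (candidates s b)
  (all-true⁻ (λ (s , b , π₁ , π₂) → any (valid s b π₁ π₂) (candidates s b)) situations all-valid
    (situations-complete (s , b , π₁ , π₂)))

module Torus (n h : ℕ) (order : suc n ≡ h + h) where

  module Column = EvenCycle n h order

  -- The vertex list is opaque: otherwise comparing two occurrences of dist G
  -- unfolds the breadth-first search in dist and conversion checking explodes.
  opaque
    torusVerts : List (Column.Vertex × Fin 4)
    torusVerts = FinGraph.verts (Cycle (suc n) □ Cycle 4)

  G : FinGraph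
  G = record
    { V     = Column.Vertex × Fin 4
    ; _≟V_  = FinGraph._≟V_ (Cycle (suc n) □ Cycle 4)
    ; verts = torusVerts
    ; adj   = FinGraph.adj (Cycle (suc n) □ Cycle 4)
    }

  Vertex : Set
  Vertex = FinGraph.V G

  opaque
    unfolding torusVerts

    G≡C□C : G ≡ Cycle (suc n) □ Cycle 4
    G≡C□C = refl

    dist-G : ∀ a b c d → dist G (a , b) (c , d) ≡ Column.distance a c + C₄.distance b d
    dist-G a b c d = dist≡ G {λ (a , b) (c , d) → Column.distance a c + C₄.distance b d}
      (□-isGraphDistance {Cycle (suc n)} {Cycle 4} Column.cycle-isGraphDistance C₄.cycle-isGraphDistance)
      (□-complete {Cycle (suc n)} {Cycle 4} ∈-allFin ∈-allFin) (a , b) (c , d)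

  move⇒near : ∀ {a b a' b'} → Move G (a , b) (a' , b') → Near b b'
  move⇒near (inj₁ refl) = inj₁ refl
  move⇒near {a} {b} {a'} {b'} (inj₂ u~v) with □-adj⁻ {Cycle (suc n)} {Cycle 4} {a} {b} {a'} {b'} u~v
  ... | inj₁ (_ , b~b') = inj₂ (C₄.adj⇒neighbours b b' b~b')
  ... | inj₂ (refl , _) = inj₁ refl

  same-response⇒ : ∀ {y c y' c'} a b → dist G (y , c) (a , b) ≡ dist G (y' , c') (a , b) →
                   Column.distance y a + C₄.distance c b ≡ Column.distance y' a + C₄.distance c' b
  same-response⇒ {y} {c} {y'} {c'} a b e = trans (sym (dist-G y c a b)) (trans e (dist-G y' c' a b))

  firstProbes : Vec Vertex 3
  firstProbes = (zero , zero) ∷ (zero , suc zero) ∷ (zero , suc (suc zero)) ∷ []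

  decodeRow-first : ∀ u → decodeRow (mapᵥ (dist G u) firstProbes) ≡ proj₂ u
  decodeRow-first (a , b) =
    trans (cong decodeRow (map-cong (λ (c , d) → dist-G a b c d) firstProbes))
          (trans (decodeRow-+ (Column.distance a zero) _ _ _) (decodeRow-rows b))

  secondProbes : Fin 4 → Vec Vertex 3
  secondProbes β = (zero , C₄.up β) ∷ (zero , C₄.down β) ∷ (fromℕ n , C₄.up β) ∷ []

  second-round-locates : ∀ β {y c y' c'} → Near β c → Near β c' →
                         mapᵥ (dist G (y , c)) (secondProbes β) ≡ mapᵥ (dist G (y' , c')) (secondProbes β) →
                         (y , c) ≡ (y' , c')
  second-round-locates β {y} {c} {y'} {c'} near near' same = cong₂ _,_ y≡y' c≡c'
    where
      answer : ∀ i → lookup (mapᵥ (dist G (y , c)) (secondProbes β)) i ≡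
                       lookup (mapᵥ (dist G (y' , c')) (secondProbes β)) i
      answer i = cong (λ v → lookup v i) same
      above : Column.distance y zero + C₄.distance c (C₄.up β) ≡
              Column.distance y' zero + C₄.distance c' (C₄.up β)
      above = same-response⇒ {y} {c} {y'} {c'} zero (C₄.up β) (answer zero)
      below : Column.distance y zero + C₄.distance c (C₄.down β) ≡
              Column.distance y' zero + C₄.distance c' (C₄.down β)
      below = same-response⇒ {y} {c} {y'} {c'} zero (C₄.down β) (answer (suc zero))
      aboveLast : Column.distance y (fromℕ n) + C₄.distance c (C₄.up β) ≡
                  Column.distance y' (fromℕ n) + C₄.distance c' (C₄.up β)
      aboveLast = same-response⇒ {y} {c} {y'} {c'} (fromℕ n) (C₄.up β) (answer (suc (suc zero)))
      c≡c' : c ≡ c'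
      c≡c' = row-determined β c c' near near'
               (+-cross {Column.distance y zero} {Column.distance y' zero}
                        {C₄.distance c (C₄.up β)} {C₄.distance c' (C₄.up β)}
                        {C₄.distance c (C₄.down β)} {C₄.distance c' (C₄.down β)} above below)
      cancel : ∀ {a a' b} → a + C₄.distance c b ≡ a' + C₄.distance c' b → a ≡ a'
      cancel {a} {a'} {b} e =
        +-cancelʳ-≡ (C₄.distance c b) a a' (trans e (cong (λ x → a' + C₄.distance x b) (sym c≡c')))
      y≡y' : y ≡ y'
      y≡y' = Column.located-by-zero-and-last y y' (cancel {b = C₄.up β} above) (cancel {b = C₄.up β} aboveLast)

  localizingStrategy : Strategy G 3
  localizingStrategy []      = firstProbes
  localizingStrategy (R ∷ _) = secondProbes (decodeRow R)

  located-at-turn-1 : ∀ r → IsRobberWalk G r → Located G localizingStrategy r 1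
  located-at-turn-1 r walk r' walk' same-history =
    sym (second-round-locates β near near' (sym same-second))
    where
      σ = localizingStrategy
      same-first : response G σ r' 0 ≡ response G σ r 0
      same-first = proj₁ (∷-injective (proj₂ (∷-injective same-history)))
      β = decodeRow (response G σ r 0)
      near : Near β (proj₂ (r 1))
      near = subst (λ b → Near b (proj₂ (r 1))) (sym (decodeRow-first (r 0))) (move⇒near (walk 0))
      near' : Near β (proj₂ (r' 1))
      near' = subst (λ b → Near b (proj₂ (r' 1)))
                (trans (sym (decodeRow-first (r' 0))) (cong decodeRow same-first)) (move⇒near (walk' 0))
      same-second : mapᵥ (dist G (r' 1)) (secondProbes β) ≡ mapᵥ (dist G (r 1)) (secondProbes β)
      same-second = trans (cong (λ R → mapᵥ (dist G (r' 1)) (secondProbes (decodeRow R))) (sym same-first))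
                          (proj₁ (∷-injective same-history))

  copWins₃ : CopWins G 3
  copWins₃ = localizingStrategy , λ r walk → 1 , located-at-turn-1 r walk

  column : Column.Vertex → Offset → Column.Vertex
  column a o₋₁ = Column.down a
  column a o₀  = a
  column a o₁  = Column.up a
  column a o₂  = Column.up (Column.up a)

  concrete : Column.Vertex → AbstractVertex → Vertex
  concrete a (o , b) = column a o , b

  rebase : Shift → Column.Vertex → Column.Vertex
  rebase back    a = Column.down a
  rebase stay    a = a
  rebase forward a = Column.up a

  rebase-place : ∀ sh a x → concrete (rebase sh a) (place stay x) ≡ concrete a (place sh x)
  rebase-place back    a (baseColumn , b) = refl
  rebase-place back    a (nextColumn , b) = cong (_, b) (Column.up-down a)
  rebase-place stay    a x                = refl
  rebase-place forward a (baseColumn , b) = refl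
  rebase-place forward a (nextColumn , b) = refl

  row-move : ∀ x {b b'} → ⌊ near? b b' ⌋ ≡ true → Move G (x , b) (x , b')
  row-move x {b} {b'} e with ⌊⌋-true⁻ (near? b b') e
  ... | inj₁ refl = inj₁ refl
  ... | inj₂ b~b' = inj₂ (□-adjʳ {Cycle (suc n)} {Cycle 4} x (C₄.neighbours⇒adj b~b'))

  column-move : ∀ {x y b b'} → ⌊ b ≟ᶠ b' ⌋ ≡ true → Column.Neighbours x y → Move G (x , b) (y , b')
  column-move {x} {y} {b} {b'} b≡b' x~y = subst (λ z → Move G (x , b) (y , z)) (⌊⌋-true⁻ (b ≟ᶠ b') b≡b')
    (inj₂ (□-adjˡ {Cycle (suc n)} {Cycle 4} b (Column.neighbours⇒adj x~y)))

  abstractMove-sound : ∀ a x y → abstractMove x y ≡ true → Move G (concrete a x) (concrete a y)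
  abstractMove-sound a (o₋₁ , b) (o₋₁ , b') e = row-move _ e
  abstractMove-sound a (o₀  , b) (o₀  , b') e = row-move _ e
  abstractMove-sound a (o₁  , b) (o₁  , b') e = row-move _ e
  abstractMove-sound a (o₂  , b) (o₂  , b') e = row-move _ e
  abstractMove-sound a (o₋₁ , b) (o₀  , b') e = column-move e (inj₁ (sym (Column.up-down a)))
  abstractMove-sound a (o₀  , b) (o₁  , b') e = column-move e (inj₁ refl)
  abstractMove-sound a (o₁  , b) (o₂  , b') e = column-move e (inj₁ refl)
  abstractMove-sound a (o₀  , b) (o₋₁ , b') e = column-move e (inj₂ (sym (Column.up-down a)))
  abstractMove-sound a (o₁  , b) (o₀  , b') e = column-move e (inj₂ refl)
  abstractMove-sound a (o₂  , b) (o₁  , b') e = column-move e (inj₂ refl)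
  abstractMove-sound a (o₋₁ , b) (o₁  , b') ()
  abstractMove-sound a (o₋₁ , b) (o₂  , b') ()
  abstractMove-sound a (o₀  , b) (o₂  , b') ()
  abstractMove-sound a (o₁  , b) (o₋₁ , b') ()
  abstractMove-sound a (o₂  , b) (o₋₁ , b') ()
  abstractMove-sound a (o₂  , b) (o₀  , b') ()

  step-down : ∀ a c → OneApart (Column.distance a c) (Column.distance (Column.down a) c)
  step-down a c = Column.neighbours-oneApart c (inj₁ (sym (Column.up-down a)))

  step-up : ∀ a c → OneApart (Column.distance (Column.up a) c) (Column.distance a c)
  step-up a c = Column.neighbours-oneApart c (inj₁ refl)

  increments : Column.Vertex → Column.Vertex → Increments
  increments a c = increased (step-down a c) , increased (step-up a c) , increased (step-up (Column.up a) c)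

  column-excess : ∀ a c o → Column.distance (column a o) c + 2 ≡
                            Column.distance a c + columnExcess (increments a c) o
  column-excess a c o₋₁ = excess-back (step-down a c)
  column-excess a c o₀  = refl
  column-excess a c o₁  = excess-forward (step-up a c)
  column-excess a c o₂  = excess-forward² (step-up a c) (step-up (Column.up a) c)

  abstraction : Column.Vertex → Vertex → AbstractProbe
  abstraction a (c , d) = increments a c , d

  dist-concrete : ∀ a x c → dist G (concrete a x) c + 2 ≡ Column.distance a (proj₁ c) + excess (abstraction a c) x
  dist-concrete a (o , b) (c , d) = begin
    dist G (column a o , b) (c , d) + 2     ≡⟨ cong (_+ 2) (dist-G (column a o) b c d) ⟩
    D-col + C₄.distance b d + 2             ≡⟨ xy∙z≈xz∙y D-col (C₄.distance b d) 2 ⟩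
    D-col + 2 + C₄.distance b d             ≡⟨ cong (_+ C₄.distance b d) (column-excess a c o) ⟩
    Column.distance a c + columnExcess (increments a c) o + C₄.distance b d
                                            ≡⟨ +-assoc (Column.distance a c) _ (C₄.distance b d) ⟩
    Column.distance a c + excess (abstraction a (c , d)) (o , b) ∎
    where open ≡-Reasoning
          D-col = Column.distance (column a o) c

  same-excess⇒same-dist : ∀ a c {x y} → excess (abstraction a c) x ≡ excess (abstraction a c) y →
                          dist G (concrete a x) c ≡ dist G (concrete a y) c
  same-excess⇒same-dist a c {x} {y} e = +-cancelʳ-≡ 2 _ _ (begin
    dist G (concrete a x) c + 2                          ≡⟨ dist-concrete a x c ⟩
    Column.distance a (proj₁ c) + excess (abstraction a c) x   ≡⟨ cong (Column.distance a (proj₁ c) +_) e ⟩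
    Column.distance a (proj₁ c) + excess (abstraction a c) y   ≡⟨ sym (dist-concrete a y c) ⟩
    dist G (concrete a y) c + 2                          ∎)
    where open ≡-Reasoning

  State : Set
  State = Column.Vertex × Shape × Fin 4

  U W : State → Vertex
  U (a , s , b) = concrete a (place stay (twinU s b))
  W (a , s , b) = concrete a (place stay (twinW s b))

  evade : ∀ st c c' → ∃[ st' ] Move G (U st) (U st') × Move G (W st) (W st') ×
                               dist G (U st') c ≡ dist G (W st') c × dist G (U st') c' ≡ dist G (W st') c'
  evade (a , s , b) c c' = follow (reply s b (abstraction a c) (abstraction a c'))
    where
      follow : ∃[ r ] valid s b (abstraction a c) (abstraction a c') r ≡ true →
               ∃[ st' ] Move G (U (a , s , b)) (U st') × Move G (W (a , s , b)) (W st') ×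
                        dist G (U st') c ≡ dist G (W st') c × dist G (U st') c' ≡ dist G (W st') c'
      follow ((s' , b' , sh) , ok) =
        (rebase sh a , s' , b') ,
        subst (Move G (U (a , s , b))) (sym (rebase-place sh a (twinU s' b')))
              (abstractMove-sound a (place stay (twinU s b)) (place sh (twinU s' b')) moveU) ,
        subst (Move G (W (a , s , b))) (sym (rebase-place sh a (twinW s' b')))
              (abstractMove-sound a (place stay (twinW s b)) (place sh (twinW s' b')) moveW) ,
        same-dist c same₁ , same-dist c' same₂
        where
          parts = valid⁻ s b (abstraction a c) (abstraction a c') s' b' sh ok
          moveU = proj₁ parts
          moveW = proj₁ (proj₂ parts)
          same₁ = proj₁ (proj₂ (proj₂ parts))
          same₂ = proj₂ (proj₂ (proj₂ parts))
          same-dist : ∀ c → excess (abstraction a c) (place sh (twinU s' b')) ≡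
                            excess (abstraction a c) (place sh (twinW s' b')) →
                      dist G (U (rebase sh a , s' , b')) c ≡ dist G (W (rebase sh a , s' , b')) c
          same-dist c e = subst₂ (λ u w → dist G u c ≡ dist G w c)
            (sym (rebase-place sh a (twinU s' b'))) (sym (rebase-place sh a (twinW s' b')))
            (same-excess⇒same-dist a c {place sh (twinU s' b')} {place sh (twinW s' b')} e)

  twinEvasion : TwinEvasion G 2
  twinEvasion = record
    { State        = State
    ; start        = zero , vertical , zero
    ; left         = U
    ; right        = W
    ; distinct     = λ (a , s , b) W≡U → twin-rows-differ s b (cong proj₂ W≡U)
    ; next         = λ { st (c ∷ c' ∷ []) → proj₁ (evade st c c') }
    ; left-moves   = λ { st (c ∷ c' ∷ []) → proj₁ (proj₂ (evade st c c')) }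
    ; right-moves  = λ { st (c ∷ c' ∷ []) → proj₁ (proj₂ (proj₂ (evade st c c'))) }
    ; same-answers = λ { st (c ∷ c' ∷ []) → let (_ , _ , _ , e , e') = evade st c c' in
                                           cong₂ _∷_ e (cong₂ _∷_ e' refl) }
    }

  localizationNumber : IsLocalizationNumber G 3
  localizationNumber = s≤s z≤n , copWins₃ , fewer-cops-lose
    where
      ¬copWins₂ : ¬ CopWins G 2
      ¬copWins₂ = twinEvasion⇒¬CopWins G 2 twinEvasion
      fewer-cops-lose : ∀ j → 1 ≤ j → j < 3 → ¬ CopWins G j
      fewer-cops-lose 1 _ _ = ¬copWins₂ ∘ CopWins-suc G
      fewer-cops-lose 2 _ _ = ¬copWins₂
      fewer-cops-lose (suc (suc (suc _))) _ (s≤s (s≤s (s≤s ())))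

proposition5p21 : (p : ℕ) → 2 ≤ p →
    IsLocalizationNumber (Cycle (2 * p) □ Cycle 4) 3
proposition5p21 p@(suc _) _ =
  -- Fixing both endpoints stops Agda from comparing the two graphs by unfolding dist.
  subst (λ m → IsLocalizationNumber (Cycle m □ Cycle 4) 3) {x = suc (pred (2 * p))} {y = 2 * p} refl
    (subst (λ H → IsLocalizationNumber H 3) G≡C□C localizationNumber)
  where open Torus (pred (2 * p)) p (cong (p +_) (+-identityʳ p))
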